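{- Let $H$ be a permutation group on a finite nonempty set $\Omega$ and let $G$ be a finite group. If $G$ is non-CCA, then $G\wr_\Omega H$ is non-CCA.
   Context: $G\wr_\Omega H=G^\Omega\rtimes H$ with $H$ permuting coordinates. For a group $G$ and inverse-closed $S\subseteq G$, $\mathrm{Cay}(G,S)$ is the edge-coloured graph on $G$ with edges $\{g,sg\}$ ($g\in G,s\in S$) coloured $\{s,s^{ -1}\}$. $\mathrm{Aut}_c$ is the group of colour-preserving graph automorphisms, $G_R$ the right regular representation, $\mathrm{Aut}_{\pm1}(G,S)=\{\alpha\in\mathrm{Aut}(G)\colon s^\alpha\in\{s,s^{ -1}\}\ \forall s\in S\}$. $\mathrm{Cay}(G,S)$ is CCA if $\mathrm{Aut}_c(\mathrm{Cay}(G,S))=G_R\rtimes\mathrm{Aut}_{\pm1}(G,S)$. A group is CCA if every connected Cayley graph on it is CCA, and non-CCA otherwise. -}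

module Defs where

open import Data.Nat using (ℕ; suc)
open import Data.Fin using (Fin)
open import Data.Bool using (Bool; true)
open import Data.Vec using (Vec; lookup; tabulate; zipWith; replicate; map)
open import Data.Product using (Σ; ∃; ∃-syntax; _×_; _,_)
open import Data.Sum using (_⊎_)
open import Relation.Binary.PropositionalEquality using (_≡_)
open import Relation.Nullary using (¬_)
open import Function.Bundles using (_↔_; _⇔_)

-- Raw group data (carrier with multiplication, identity, inverse).
-- CCA / non-CCA only refer to these operations.

record RawGrp : Set₁ where
  field
    Carrier : Set
    _∙_     : Carrier → Carrier → Carrier
    ε       : Carrier
    _⁻¹     : Carrier → Carrier
  infixl 7 _∙_
  infix  8 _⁻¹

record FinGroup : Set₁ where
  field
    raw : RawGrp
  open RawGrp raw public
  field
    assoc     : ∀ x y z → (x ∙ y) ∙ z ≡ x ∙ (y ∙ z)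
    identityˡ : ∀ x → ε ∙ x ≡ x
    identityʳ : ∀ x → x ∙ ε ≡ x
    inverseˡ  : ∀ x → x ⁻¹ ∙ x ≡ ε
    inverseʳ  : ∀ x → x ∙ x ⁻¹ ≡ ε
    size      : ℕ
    finite    : Carrier ↔ Fin size

-- A permutation group H on Ω = Fin m: a finite group H with a faithful
-- (left) action on Fin m, i.e. H is identified with its image in Sym(Ω).
record PermGroup (m : ℕ) : Set₁ where
  field
    grp : FinGroup
  open FinGroup grp public
  field
    act      : Carrier → Fin m → Fin m
    act-ε    : ∀ i → act ε i ≡ i
    act-∙    : ∀ h k i → act (h ∙ k) i ≡ act h (act k i)
    faithful : ∀ h k → (∀ i → act h i ≡ act k i) → h ≡ k

-- Wreath product G ≀_Ω H = G^Ω ⋊ H, H permuting coordinates: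
--   (h · f)(i) = f (h⁻¹ i),
--   (f , h)(f' , h') = (f · (h · f') , h h'),
--   (f , h)⁻¹ = (h⁻¹ · f⁻¹ , h⁻¹).

module _ (G : FinGroup) {m : ℕ} (H : PermGroup m) where
  private
    module G = FinGroup G
    module H = PermGroup H

  permute : H.Carrier → Vec G.Carrier m → Vec G.Carrier m
  permute h f = tabulate (λ i → lookup f (H.act (h H.⁻¹) i))

  wreath : RawGrp
  wreath = record
    { Carrier = Vec G.Carrier m × H.Carrier
    ; _∙_ = λ { (f , h) (f′ , h′) → zipWith G._∙_ f (permute h f′) , h H.∙ h′ }
    ; ε = replicate m G.ε , H.ε
    ; _⁻¹ = λ { (f , h) → permute (h H.⁻¹) (map G._⁻¹ f) , h H.⁻¹ }
    }

-- Cayley graphs and CCA.  A subset S ⊆ G is a Boolean predicate.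

module _ (G : RawGrp) where
  open RawGrp G

  _∈S_ : Carrier → (Carrier → Bool) → Set
  s ∈S S = S s ≡ true

  InverseClosed : (Carrier → Bool) → Set
  InverseClosed S = ∀ s → s ∈S S → (s ⁻¹) ∈S S

  -- reachability in Cay(G,S) along edges {g, s g}
  data Reach (S : Carrier → Bool) (x : Carrier) : Carrier → Set where
    here : Reach S x x
    step : ∀ {y} s → s ∈S S → Reach S x y → Reach S x (s ∙ y)

  Connected : (Carrier → Bool) → Set
  Connected S = ∀ x y → Reach S x y

  -- φ maps every edge {x, s x} (colour {s, s⁻¹}) to an edge of colour {s, s⁻¹}
  ColourPreserving : (Carrier → Bool) → (Carrier → Carrier) → Set
  ColourPreserving S φ =
    ∀ x s → s ∈S S → (φ (s ∙ x) ≡ s ∙ φ x) ⊎ (φ (s ∙ x) ≡ (s ⁻¹) ∙ φ x)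

  IsColourAut : (Carrier → Bool) → (Carrier → Carrier) → Set
  IsColourAut S φ = Σ (Carrier → Carrier) λ ψ →
    (∀ x → ψ (φ x) ≡ x) × (∀ x → φ (ψ x) ≡ x) ×
    ColourPreserving S φ × ColourPreserving S ψ

  IsAutPM1 : (Carrier → Bool) → (Carrier → Carrier) → Set
  IsAutPM1 S α = Σ (Carrier → Carrier) λ β →
    (∀ x → β (α x) ≡ x) × (∀ x → α (β x) ≡ x) ×
    (∀ x y → α (x ∙ y) ≡ α x ∙ α y) ×
    (∀ s → s ∈S S → (α s ≡ s) ⊎ (α s ≡ s ⁻¹))

  InGRAut : (Carrier → Bool) → (Carrier → Carrier) → Set
  InGRAut S φ = ∃[ α ] ∃[ g ] (IsAutPM1 S α × (∀ x → φ x ≡ α x ∙ g))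

  CayleyCCA : (Carrier → Bool) → Set
  CayleyCCA S = ∀ φ → IsColourAut S φ ⇔ InGRAut S φ

  NonCCA : Set
  NonCCA = ∃[ S ] (InverseClosed S × Connected S × ¬ CayleyCCA S)

-- Let Cay(G,S) be connected but not CCA.  In W = G ≀_Ω H take the connection set T consisting of
-- the elements s ∈ S placed in a single coordinate (with trivial top component) together with the
-- whole top group H.  Cay(W,T) is connected: H moves between top components, and the coordinate
-- generators walk each coordinate through Cay(G,S) independently.  A colour-preserving
-- automorphism φ of Cay(G,S), applied in every coordinate, is a colour-preserving automorphism
-- of Cay(W,T).  If Cay(W,T) were CCA this lift would be x ↦ A x · g with A ∈ Aut±1(W,T); A then
-- maps the copy of G in one coordinate onto itself, and restricting there exhibits φ as an element
-- of G_R ⋊ Aut±1(G,S), contradicting the choice of S.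

module Submission where

open import Defs
open import Level using (0ℓ)
open import Algebra.Bundles using (Group)
import Algebra.Properties.Group as GroupProperties
open import Data.Nat using (ℕ; suc)
open import Data.Fin using (Fin; zero)
import Data.Fin.Properties as Fin
open import Data.Bool using (Bool; true)
open import Data.Bool.Properties using (T-≡) renaming (_≟_ to _≟ᴮ_)
open import Data.Vec using (Vec; lookup; zipWith; replicate; map; _[_]≔_)
open import Data.Vec.Properties
open import Data.List using ([]; _∷_; allFin)
open import Data.List.Membership.Propositional using (_∉_)
open import Data.List.Membership.Propositional.Properties using (∈-allFin)
open import Data.List.Relation.Unary.Any using (here; there)
open import Data.Product using (∃-syntax; _×_; _,_; proj₁; proj₂)
open import Data.Sum as Sum using (_⊎_; inj₁; inj₂)
open import Function using (_∘_; id)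
open import Function.Bundles using (mk⇔; Equivalence)
open import Function.Properties.Inverse using (Inverse⇒Injection)
open import Relation.Binary.Definitions using (DecidableEquality)
open import Relation.Binary.PropositionalEquality
open import Relation.Nullary using (Dec; yes; no; contradiction)
open import Relation.Nullary.Decidable using (via-injection; ⌊_⌋; toWitness; fromWitness; _×-dec_; _⊎-dec_)
import Relation.Nullary.Decidable as Dec

module FinGroupProperties (K : FinGroup) where
  open FinGroup K

  group : Group 0ℓ 0ℓ
  group = record
    { isGroup = record
      { isMonoid = record
        { isSemigroup = record
          { isMagma = record { isEquivalence = isEquivalence ; ∙-cong = cong₂ _∙_ }
          ; assoc = assoc
          }
        ; identity = identityˡ , identityʳ
        }
      ; inverse = inverseˡ , inverseʳ
      ; ⁻¹-cong = cong _⁻¹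
      }
    }

  open GroupProperties group public

  _≟_ : DecidableEquality Carrier
  _≟_ = via-injection (Inverse⇒Injection finite) Fin._≟_

  module _ {f : Carrier → Carrier} (f-hom : ∀ x y → f (x ∙ y) ≡ f x ∙ f y) where

    homomorphism-ε : f ε ≡ ε
    homomorphism-ε = identityˡ-unique (f ε) (f ε) (trans (sym (f-hom ε ε)) (cong f (identityˡ ε)))

    homomorphism-⁻¹ : ∀ x → f (x ⁻¹) ≡ f x ⁻¹
    homomorphism-⁻¹ x = inverseˡ-unique (f (x ⁻¹)) (f x)
      (trans (sym (f-hom (x ⁻¹) x)) (trans (cong f (inverseˡ x)) homomorphism-ε))

module _ (K : RawGrp) {S : RawGrp.Carrier K → Bool} where
  open RawGrp K

  reach-trans : ∀ {x y z} → Reach K S x y → Reach K S y z → Reach K S x z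
  reach-trans r here            = r
  reach-trans r (step s s∈ r′) = step s s∈ (reach-trans r r′)

  colourPreserving-resp : ∀ {φ φ′} → (∀ x → φ x ≡ φ′ x) →
                          ColourPreserving K S φ′ → ColourPreserving K S φ
  colourPreserving-resp {φ} {φ′} φ≗φ′ cp x s s∈ =
    Sum.map (transport s) (transport (s ⁻¹)) (cp x s s∈)
    where
    transport : ∀ t → φ′ (s ∙ x) ≡ t ∙ φ′ x → φ (s ∙ x) ≡ t ∙ φ x
    transport t eq = trans (φ≗φ′ (s ∙ x)) (trans eq (cong (t ∙_) (sym (φ≗φ′ x))))

module _ (K : FinGroup) {S : FinGroup.Carrier K → Bool} where
  open FinGroup K
  open FinGroupProperties K
  open ≡-Reasoning

  autPM1-inverse : ∀ {α} → (α-aut : IsAutPM1 raw S α) → IsAutPM1 raw S (proj₁ α-aut)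
  autPM1-inverse {α} (β , βα , αβ , α-hom , α-sign) = α , αβ , βα , β-hom , β-sign
    where
    β-hom : ∀ x y → β (x ∙ y) ≡ β x ∙ β y
    β-hom x y = begin
      β (x ∙ y)              ≡⟨ cong₂ (λ u v → β (u ∙ v)) (αβ x) (αβ y) ⟨
      β (α (β x) ∙ α (β y))  ≡⟨ cong β (α-hom (β x) (β y)) ⟨
      β (α (β x ∙ β y))      ≡⟨ βα (β x ∙ β y) ⟩
      β x ∙ β y              ∎
    β-sign : ∀ s → _∈S_ raw s S → (β s ≡ s) ⊎ (β s ≡ s ⁻¹)
    β-sign s s∈ with α-sign s s∈
    ... | inj₁ αs≡s   = inj₁ (trans (cong β (sym αs≡s)) (βα s))
    ... | inj₂ αs≡s⁻¹ = inj₂ (begin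
      β s             ≡⟨ cong β (⁻¹-involutive s) ⟨
      β (s ⁻¹ ⁻¹)     ≡⟨ cong (λ t → β (t ⁻¹)) αs≡s⁻¹ ⟨
      β (α s ⁻¹)      ≡⟨ cong β (homomorphism-⁻¹ α-hom s) ⟨
      β (α (s ⁻¹))    ≡⟨ βα (s ⁻¹) ⟩
      s ⁻¹            ∎)

  autPM1-translate-colourPreserving : ∀ {α} → IsAutPM1 raw S α → ∀ g →
                                      ColourPreserving raw S (λ x → α x ∙ g)
  autPM1-translate-colourPreserving {α} (_ , _ , _ , α-hom , α-sign) g x s s∈ =
    Sum.map translate translate (α-sign s s∈)
    where
    translate : ∀ {t} → α s ≡ t → α (s ∙ x) ∙ g ≡ t ∙ (α x ∙ g)
    translate {t} αs≡t = begin
      α (s ∙ x) ∙ g    ≡⟨ cong (_∙ g) (α-hom s x) ⟩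
      α s ∙ α x ∙ g    ≡⟨ assoc (α s) (α x) g ⟩
      α s ∙ (α x ∙ g)  ≡⟨ cong (_∙ (α x ∙ g)) αs≡t ⟩
      t ∙ (α x ∙ g)    ∎

  GRAut⇒colourAut : ∀ φ → InGRAut raw S φ → IsColourAut raw S φ
  GRAut⇒colourAut φ (α , g , α-aut@(β , βα , αβ , α-hom , _) , φ≗)
    with autPM1-inverse α-aut
  ... | β-aut@(_ , _ , _ , β-hom , _) =
    ψ , ψφ , φψ ,
    colourPreserving-resp raw φ≗ (autPM1-translate-colourPreserving α-aut g) ,
    autPM1-translate-colourPreserving β-aut (β (g ⁻¹))
    where
    ψ : Carrier → Carrier
    ψ x = β x ∙ β (g ⁻¹)
    ψφ : ∀ x → ψ (φ x) ≡ x
    ψφ x = begin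
      β (φ x) ∙ β (g ⁻¹)        ≡⟨ cong (λ y → β y ∙ β (g ⁻¹)) (φ≗ x) ⟩
      β (α x ∙ g) ∙ β (g ⁻¹)    ≡⟨ β-hom (α x ∙ g) (g ⁻¹) ⟨
      β (α x ∙ g ∙ g ⁻¹)        ≡⟨ cong β (//-rightDividesʳ g (α x)) ⟩
      β (α x)                   ≡⟨ βα x ⟩
      x                         ∎
    φψ : ∀ x → φ (ψ x) ≡ x
    φψ x = begin
      φ (β x ∙ β (g ⁻¹))          ≡⟨ φ≗ (β x ∙ β (g ⁻¹)) ⟩
      α (β x ∙ β (g ⁻¹)) ∙ g      ≡⟨ cong (_∙ g) (α-hom (β x) (β (g ⁻¹))) ⟩
      α (β x) ∙ α (β (g ⁻¹)) ∙ g  ≡⟨ cong₂ (λ u v → u ∙ v ∙ g) (αβ x) (αβ (g ⁻¹)) ⟩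
      x ∙ g ⁻¹ ∙ g                ≡⟨ //-rightDividesˡ g x ⟩
      x                           ∎

module _ (K W : RawGrp) {S : RawGrp.Carrier K → Bool} {T : RawGrp.Carrier W → Bool} where
  private
    module K = RawGrp K
    module W = RawGrp W
  open ≡-Reasoning

  autPM1-restrict :
    ∀ {d : K.Carrier → W.Carrier} {A : W.Carrier → W.Carrier} {α β : K.Carrier → K.Carrier} →
    (∀ {a b} → d a ≡ d b → a ≡ b) →
    (∀ a b → d (a K.∙ b) ≡ d a W.∙ d b) →
    (∀ a → d (a K.⁻¹) ≡ d a W.⁻¹) →
    (∀ s → _∈S_ K s S → _∈S_ W (d s) T) →
    IsAutPM1 W T A → (∀ a → A (d a) ≡ d (α a)) →
    (∀ x → β (α x) ≡ x) → (∀ x → α (β x) ≡ x) →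
    IsAutPM1 K S α
  autPM1-restrict {d} {A} {α} {β} d-injective d-hom d-⁻¹ d-gen (_ , _ , _ , A-hom , A-sign) A∘d βα αβ =
    β , βα , αβ , α-hom , α-sign
    where
    α-hom : ∀ a b → α (a K.∙ b) ≡ α a K.∙ α b
    α-hom a b = d-injective (begin
      d (α (a K.∙ b))          ≡⟨ A∘d (a K.∙ b) ⟨
      A (d (a K.∙ b))          ≡⟨ cong A (d-hom a b) ⟩
      A (d a W.∙ d b)          ≡⟨ A-hom (d a) (d b) ⟩
      A (d a) W.∙ A (d b)      ≡⟨ cong₂ W._∙_ (A∘d a) (A∘d b) ⟩
      d (α a) W.∙ d (α b)      ≡⟨ d-hom (α a) (α b) ⟨
      d (α a K.∙ α b)          ∎)
    α-sign : ∀ s → _∈S_ K s S → (α s ≡ s) ⊎ (α s ≡ s K.⁻¹)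
    α-sign s s∈ with A-sign (d s) (d-gen s s∈)
    ... | inj₁ Ads≡ds   = inj₁ (d-injective (trans (sym (A∘d s)) Ads≡ds))
    ... | inj₂ Ads≡ds⁻¹ = inj₂ (d-injective (trans (sym (A∘d s)) (trans Ads≡ds⁻¹ (sym (d-⁻¹ s)))))

lookup-extensionality : ∀ {A : Set} {n} {u v : Vec A n} → (∀ i → lookup u i ≡ lookup v i) → u ≡ v
lookup-extensionality {u = u} {v} u≗v =
  trans (sym (tabulate∘lookup u)) (trans (tabulate-cong u≗v) (tabulate∘lookup v))

module WreathProduct (G : FinGroup) {n : ℕ} (H : PermGroup n) where
  private
    module G  = FinGroup G
    module H  = PermGroup H
    module GP = FinGroupProperties G
    module HP = FinGroupProperties H.grp
  open ≡-Reasoning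

  W : RawGrp
  W = wreath G H
  module W = RawGrp W

  εᵛ : Vec G.Carrier n
  εᵛ = replicate n G.ε

  single : Fin n → G.Carrier → Vec G.Carrier n
  single i s = εᵛ [ i ]≔ s

  lookup-permute : ∀ h f i → lookup (permute G H h f) i ≡ lookup f (H.act (h H.⁻¹) i)
  lookup-permute h f = lookup∘tabulate (λ i → lookup f (H.act (h H.⁻¹) i))

  permute-ε : ∀ f → permute G H H.ε f ≡ f
  permute-ε f = lookup-extensionality λ i → begin
    lookup (permute G H H.ε f) i      ≡⟨ lookup-permute H.ε f i ⟩
    lookup f (H.act (H.ε H.⁻¹) i)     ≡⟨ cong (λ h → lookup f (H.act h i)) HP.ε⁻¹≈ε ⟩
    lookup f (H.act H.ε i)            ≡⟨ cong (lookup f) (H.act-ε i) ⟩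
    lookup f i                        ∎

  permute-replicate : ∀ h x → permute G H h (replicate n x) ≡ replicate n x
  permute-replicate h x = lookup-extensionality λ i →
    trans (lookup-permute h (replicate n x) i)
          (trans (lookup-replicate (H.act (h H.⁻¹) i) x) (sym (lookup-replicate i x)))

  map-permute : ∀ φ h f → map φ (permute G H h f) ≡ permute G H h (map φ f)
  map-permute φ h f = trans (sym (tabulate-∘ φ _)) (tabulate-cong λ i → sym (lookup-map _ φ f))

  zipWith-εᵛ : ∀ f → zipWith G._∙_ εᵛ f ≡ f
  zipWith-εᵛ f = trans (zipWith-replicate₁ G._∙_ G.ε f) (trans (map-cong G.identityˡ f) (map-id f))

  zipWith-single : ∀ i s u → zipWith G._∙_ (single i s) u ≡ u [ i ]≔ (s G.∙ lookup u i)
  zipWith-single i s u = lookup-extensionality pointwise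
    where
    pointwise : ∀ j → lookup (zipWith G._∙_ (single i s) u) j ≡ lookup (u [ i ]≔ (s G.∙ lookup u i)) j
    pointwise j with j Fin.≟ i
    ... | yes refl = begin
      lookup (zipWith G._∙_ (single j s) u) j  ≡⟨ lookup-zipWith G._∙_ j (single j s) u ⟩
      lookup (single j s) j G.∙ lookup u j     ≡⟨ cong (G._∙ lookup u j) (lookup∘update j εᵛ s) ⟩
      s G.∙ lookup u j                         ≡⟨ lookup∘update j u (s G.∙ lookup u j) ⟨
      lookup (u [ j ]≔ (s G.∙ lookup u j)) j   ∎
    ... | no j≢i = begin
      lookup (zipWith G._∙_ (single i s) u) j  ≡⟨ lookup-zipWith G._∙_ j (single i s) u ⟩
      lookup (single i s) j G.∙ lookup u j     ≡⟨ cong (G._∙ lookup u j) (lookup∘update′ j≢i εᵛ s) ⟩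
      lookup εᵛ j G.∙ lookup u j               ≡⟨ cong (G._∙ lookup u j) (lookup-replicate j G.ε) ⟩
      G.ε G.∙ lookup u j                       ≡⟨ G.identityˡ (lookup u j) ⟩
      lookup u j                               ≡⟨ lookup∘update′ j≢i u _ ⟨
      lookup (u [ i ]≔ (s G.∙ lookup u i)) j   ∎

  top-∙ : ∀ k f h → (εᵛ , k) W.∙ (f , h) ≡ (permute G H k f , k H.∙ h)
  top-∙ k f h = cong (_, k H.∙ h) (zipWith-εᵛ (permute G H k f))

  top-⁻¹ : ∀ k → (εᵛ , k) W.⁻¹ ≡ (εᵛ , k H.⁻¹)
  top-⁻¹ k = cong (_, k H.⁻¹) (begin
    permute G H (k H.⁻¹) (map G._⁻¹ εᵛ)
      ≡⟨ cong (permute G H (k H.⁻¹)) (map-replicate G._⁻¹ G.ε n) ⟩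
    permute G H (k H.⁻¹) (replicate n (G.ε G.⁻¹))
      ≡⟨ permute-replicate (k H.⁻¹) (G.ε G.⁻¹) ⟩
    replicate n (G.ε G.⁻¹)
      ≡⟨ cong (replicate n) GP.ε⁻¹≈ε ⟩
    εᵛ
      ∎)

  single-∙ : ∀ i s u h → (single i s , H.ε) W.∙ (u , h) ≡ (u [ i ]≔ (s G.∙ lookup u i) , h)
  single-∙ i s u h = cong₂ _,_
    (trans (cong (zipWith G._∙_ (single i s)) (permute-ε u)) (zipWith-single i s u))
    (H.identityˡ h)

  single-∙-update : ∀ i s u y h → (single i s , H.ε) W.∙ (u [ i ]≔ y , h) ≡ (u [ i ]≔ (s G.∙ y) , h)
  single-∙-update i s u y h = trans (single-∙ i s (u [ i ]≔ y) h) (cong (_, h) (begin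
    (u [ i ]≔ y) [ i ]≔ (s G.∙ lookup (u [ i ]≔ y) i)
      ≡⟨ []≔-idempotent u i ⟩
    u [ i ]≔ (s G.∙ lookup (u [ i ]≔ y) i)
      ≡⟨ cong (λ t → u [ i ]≔ (s G.∙ t)) (lookup∘update i u y) ⟩
    u [ i ]≔ (s G.∙ y)
      ∎))

  single-⁻¹ : ∀ i s → (single i s , H.ε) W.⁻¹ ≡ (single i (s G.⁻¹) , H.ε)
  single-⁻¹ i s = cong₂ _,_ (begin
    permute G H (H.ε H.⁻¹) (map G._⁻¹ (single i s))
      ≡⟨ cong (λ h → permute G H h (map G._⁻¹ (single i s))) HP.ε⁻¹≈ε ⟩
    permute G H H.ε (map G._⁻¹ (single i s))
      ≡⟨ permute-ε (map G._⁻¹ (single i s)) ⟩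
    map G._⁻¹ (single i s)
      ≡⟨ map-[]≔ G._⁻¹ εᵛ i ⟩
    map G._⁻¹ εᵛ [ i ]≔ s G.⁻¹
      ≡⟨ cong (_[ i ]≔ s G.⁻¹) (map-replicate G._⁻¹ G.ε n) ⟩
    replicate n (G.ε G.⁻¹) [ i ]≔ s G.⁻¹
      ≡⟨ cong (λ e → replicate n e [ i ]≔ s G.⁻¹) GP.ε⁻¹≈ε ⟩
    single i (s G.⁻¹)
      ∎) HP.ε⁻¹≈ε

  -- Left identity and right cancellation are all the group structure of W the argument needs.
  W-identityˡ : ∀ w → W.ε W.∙ w ≡ w
  W-identityˡ (f , h) = trans (top-∙ H.ε f h) (cong₂ _,_ (permute-ε f) (H.identityˡ h))

  W-cancelʳ : ∀ u v w → u W.∙ w ≡ v W.∙ w → u ≡ v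
  W-cancelʳ (f , h) (f′ , h′) (c , k) eq with HP.∙-cancelʳ k h h′ (cong proj₂ eq)
  ... | refl = cong (_, h) (lookup-extensionality λ j →
    GP.∙-cancelʳ (lookup (permute G H h c) j) (lookup f j) (lookup f′ j) (begin
      lookup f j G.∙ lookup (permute G H h c) j   ≡⟨ lookup-zipWith G._∙_ j f (permute G H h c) ⟨
      lookup (proj₁ ((f , h) W.∙ (c , k))) j      ≡⟨ cong (λ w → lookup (proj₁ w) j) eq ⟩
      lookup (proj₁ ((f′ , h) W.∙ (c , k))) j     ≡⟨ lookup-zipWith G._∙_ j f′ (permute G H h c) ⟩
      lookup f′ j G.∙ lookup (permute G H h c) j  ∎))

  homomorphism-W-ε : ∀ {A : W.Carrier → W.Carrier} →
                     (∀ x y → A (x W.∙ y) ≡ A x W.∙ A y) → A W.ε ≡ W.ε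
  homomorphism-W-ε {A} A-hom = W-cancelʳ (A W.ε) W.ε (A W.ε) (begin
    A W.ε W.∙ A W.ε   ≡⟨ A-hom W.ε W.ε ⟨
    A (W.ε W.∙ W.ε)   ≡⟨ cong A (W-identityˡ W.ε) ⟩
    A W.ε             ≡⟨ W-identityˡ (A W.ε) ⟨
    W.ε W.∙ A W.ε     ∎)

  GRAut-translation : ∀ {T Φ} → (Φ-GR : InGRAut W T Φ) →
                      ∀ x → Φ x ≡ proj₁ Φ-GR x W.∙ Φ W.ε
  GRAut-translation {Φ = Φ} (A , g , (_ , _ , _ , A-hom , _) , Φ≗) x = begin
    Φ x                  ≡⟨ Φ≗ x ⟩
    A x W.∙ g            ≡⟨ cong (A x W.∙_) (W-identityˡ g) ⟨
    A x W.∙ (W.ε W.∙ g)  ≡⟨ cong (λ e → A x W.∙ (e W.∙ g)) (homomorphism-W-ε A-hom) ⟨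
    A x W.∙ (A W.ε W.∙ g) ≡⟨ cong (A x W.∙_) (Φ≗ W.ε) ⟨
    A x W.∙ Φ W.ε        ∎

  embed : Fin n → G.Carrier → W.Carrier
  embed i a = single i a , H.ε

  embed-injective : ∀ i {a b} → embed i a ≡ embed i b → a ≡ b
  embed-injective i {a} {b} eq = begin
    a                        ≡⟨ lookup∘update i εᵛ a ⟨
    lookup (single i a) i    ≡⟨ cong (λ w → lookup (proj₁ w) i) eq ⟩
    lookup (single i b) i    ≡⟨ lookup∘update i εᵛ b ⟩
    b                        ∎

  embed-hom : ∀ i a b → embed i (a G.∙ b) ≡ embed i a W.∙ embed i b
  embed-hom i a b = sym (single-∙-update i a εᵛ b H.ε)

  embed-⁻¹ : ∀ i a → embed i (a G.⁻¹) ≡ embed i a W.⁻¹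
  embed-⁻¹ i a = sym (single-⁻¹ i a)

  liftMap : (G.Carrier → G.Carrier) → W.Carrier → W.Carrier
  liftMap φ (f , h) = map φ f , h

  liftMap-inverse : ∀ {φ ψ} → (∀ x → ψ (φ x) ≡ x) → ∀ w → liftMap ψ (liftMap φ w) ≡ w
  liftMap-inverse {φ} {ψ} ψφ (f , h) = cong (_, h) (begin
    map ψ (map φ f)   ≡⟨ map-∘ ψ φ f ⟨
    map (ψ ∘ φ) f     ≡⟨ map-cong ψφ f ⟩
    map id f          ≡⟨ map-id f ⟩
    f                 ∎)

  liftMap-embed : ∀ φ i a → liftMap φ (embed i a) ≡ embed i (φ a G.∙ φ G.ε G.⁻¹) W.∙ liftMap φ W.ε
  liftMap-embed φ i a = begin
    (map φ (single i a) , H.ε)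
      ≡⟨ cong (_, H.ε) (map-[]≔ φ εᵛ i) ⟩
    (map φ εᵛ [ i ]≔ φ a , H.ε)
      ≡⟨ cong (λ x → map φ εᵛ [ i ]≔ x , H.ε) (GP.//-rightDividesˡ (φ G.ε) (φ a)) ⟨
    (map φ εᵛ [ i ]≔ (α a G.∙ φ G.ε) , H.ε)
      ≡⟨ cong (λ x → map φ εᵛ [ i ]≔ (α a G.∙ x) , H.ε) lookup-φεᵛ ⟨
    (map φ εᵛ [ i ]≔ (α a G.∙ lookup (map φ εᵛ) i) , H.ε)
      ≡⟨ single-∙ i (α a) (map φ εᵛ) H.ε ⟨
    embed i (α a) W.∙ liftMap φ W.ε
      ∎
    where
    α : G.Carrier → G.Carrier
    α x = φ x G.∙ φ G.ε G.⁻¹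
    lookup-φεᵛ : lookup (map φ εᵛ) i ≡ φ G.ε
    lookup-φεᵛ = trans (lookup-map i φ εᵛ) (cong φ (lookup-replicate i G.ε))

  module _ (S₀ : G.Carrier → Bool) where

    data Generator : W.Carrier → Set where
      coordinate : ∀ i {s} → _∈S_ G.raw s S₀ → Generator (single i s , H.ε)
      top        : ∀ k → Generator (εᵛ , k)

    generator? : ∀ w → Dec (Generator w)
    generator? (f , h) = Dec.map (mk⇔ from to)
      ((h HP.≟ H.ε ×-dec Fin.any? λ i →
          (S₀ (lookup f i) ≟ᴮ true) ×-dec ≡-dec GP._≟_ f (single i (lookup f i)))
       ⊎-dec ≡-dec GP._≟_ f εᵛ)
      where
      Shape : Set
      Shape = (h ≡ H.ε × ∃[ i ] (_∈S_ G.raw (lookup f i) S₀ × f ≡ single i (lookup f i))) ⊎ f ≡ εᵛ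
      from : Shape → Generator (f , h)
      from (inj₁ (refl , i , s∈ , f≡)) = subst (λ v → Generator (v , H.ε)) (sym f≡) (coordinate i s∈)
      from (inj₂ refl)                 = top h
      to : Generator (f , h) → Shape
      to (coordinate i {s} s∈) = inj₁ (refl , i ,
        subst (λ t → _∈S_ G.raw t S₀) (sym (lookup∘update i εᵛ s)) s∈ ,
        cong (single i) (sym (lookup∘update i εᵛ s)))
      to (top k) = inj₂ refl

    connectionSet : W.Carrier → Bool
    connectionSet w = ⌊ generator? w ⌋

    generator-sound : ∀ {w} → _∈S_ W w connectionSet → Generator w
    generator-sound w∈ = toWitness (Equivalence.from T-≡ w∈)

    generator-complete : ∀ {w} → Generator w → _∈S_ W w connectionSet
    generator-complete g = Equivalence.to T-≡ (fromWitness g)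

    connectionSet-inverseClosed : InverseClosed G.raw S₀ → InverseClosed W connectionSet
    connectionSet-inverseClosed S₀⁻¹ w w∈ with generator-sound w∈
    ... | coordinate i {s} s∈ = subst (λ v → _∈S_ W v connectionSet) (sym (single-⁻¹ i s))
                                      (generator-complete (coordinate i (S₀⁻¹ s s∈)))
    ... | top k                = subst (λ v → _∈S_ W v connectionSet) (sym (top-⁻¹ k))
                                      (generator-complete (top (k H.⁻¹)))

    reach-coordinate : ∀ {a b} → Reach G.raw S₀ a b → ∀ i u h →
                       Reach W connectionSet (u [ i ]≔ a , h) (u [ i ]≔ b , h)
    reach-coordinate here i u h = here
    reach-coordinate (step {y} s s∈ r) i u h =
      subst (Reach W connectionSet _) (single-∙-update i s u y h)
        (step (single i s , H.ε) (generator-complete (coordinate i s∈)) (reach-coordinate r i u h))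

    reach-agreeing : Connected G.raw S₀ → ∀ is h u v → (∀ j → j ∉ is → lookup u j ≡ lookup v j) →
                     Reach W connectionSet (u , h) (v , h)
    reach-agreeing _ [] h u v agree =
      subst (Reach W connectionSet (u , h)) (cong (_, h) (lookup-extensionality λ j → agree j λ ())) here
    reach-agreeing S₀-connected (i ∷ is) h u v agree = reach-trans W
      (subst (λ x → Reach W connectionSet (x , h) (u [ i ]≔ lookup v i , h)) ([]≔-lookup u i)
        (reach-coordinate (S₀-connected (lookup u i) (lookup v i)) i u h))
      (reach-agreeing S₀-connected is h (u [ i ]≔ lookup v i) v agree′)
      where
      agree′ : ∀ j → j ∉ is → lookup (u [ i ]≔ lookup v i) j ≡ lookup v j
      agree′ j j∉is with j Fin.≟ i
      ... | yes refl = lookup∘update j u (lookup v j)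
      ... | no j≢i   = trans (lookup∘update′ j≢i u (lookup v i))
        (agree j λ { (here j≡i) → j≢i j≡i ; (there j∈is) → j∉is j∈is })

    connectionSet-connected : Connected G.raw S₀ → Connected W connectionSet
    connectionSet-connected S₀-connected (f , h) (f′ , h′) = reach-trans W
      (subst (Reach W connectionSet (f , h)) k∙fh≡ (step (εᵛ , k) (generator-complete (top k)) here))
      (reach-agreeing S₀-connected (allFin n) h′ (permute G H k f) f′ λ j j∉ → contradiction (∈-allFin j) j∉)
      where
      k : H.Carrier
      k = h′ H.∙ h H.⁻¹
      k∙fh≡ : (εᵛ , k) W.∙ (f , h) ≡ (permute G H k f , h′)
      k∙fh≡ = trans (top-∙ k f h) (cong (permute G H k f ,_) (HP.//-rightDividesˡ h h′))

    liftMap-colourPreserving : ∀ {φ} → ColourPreserving G.raw S₀ φ →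
                               ColourPreserving W connectionSet (liftMap φ)
    liftMap-colourPreserving {φ} φ-cp (f , h) w w∈ with generator-sound w∈
    ... | top k = inj₁ (begin
      liftMap φ ((εᵛ , k) W.∙ (f , h))     ≡⟨ cong (liftMap φ) (top-∙ k f h) ⟩
      (map φ (permute G H k f) , k H.∙ h)  ≡⟨ cong (_, k H.∙ h) (map-permute φ k f) ⟩
      (permute G H k (map φ f) , k H.∙ h)  ≡⟨ top-∙ k (map φ f) h ⟨
      (εᵛ , k) W.∙ liftMap φ (f , h)       ∎)
    ... | coordinate i {s} s∈ =
      Sum.map (moved s)
              (λ eq → trans (moved (s G.⁻¹) eq) (cong (W._∙ liftMap φ (f , h)) (sym (single-⁻¹ i s))))
              (φ-cp (lookup f i) s s∈)
      where
      moved : ∀ t → φ (s G.∙ lookup f i) ≡ t G.∙ φ (lookup f i) →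
              liftMap φ ((single i s , H.ε) W.∙ (f , h)) ≡ (single i t , H.ε) W.∙ liftMap φ (f , h)
      moved t eq = begin
        liftMap φ ((single i s , H.ε) W.∙ (f , h))
          ≡⟨ cong (liftMap φ) (single-∙ i s f h) ⟩
        (map φ (f [ i ]≔ (s G.∙ lookup f i)) , h)
          ≡⟨ cong (_, h) (map-[]≔ φ f i) ⟩
        (map φ f [ i ]≔ φ (s G.∙ lookup f i) , h)
          ≡⟨ cong (λ x → map φ f [ i ]≔ x , h) eq ⟩
        (map φ f [ i ]≔ (t G.∙ φ (lookup f i)) , h)
          ≡⟨ cong (λ x → map φ f [ i ]≔ (t G.∙ x) , h) (lookup-map i φ f) ⟨
        (map φ f [ i ]≔ (t G.∙ lookup (map φ f) i) , h)
          ≡⟨ single-∙ i t (map φ f) h ⟨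
        (single i t , H.ε) W.∙ liftMap φ (f , h)
          ∎

    liftMap-colourAut : ∀ {φ} → IsColourAut G.raw S₀ φ → IsColourAut W connectionSet (liftMap φ)
    liftMap-colourAut (ψ , ψφ , φψ , φ-cp , ψ-cp) =
      liftMap ψ , liftMap-inverse ψφ , liftMap-inverse φψ ,
      liftMap-colourPreserving φ-cp , liftMap-colourPreserving ψ-cp

    colourAut⇒GRAut : Fin n → CayleyCCA W connectionSet →
                      ∀ φ → IsColourAut G.raw S₀ φ → InGRAut G.raw S₀ φ
    colourAut⇒GRAut i W-cca φ φ-aut@(ψ , ψφ , φψ , _)
      with Equivalence.to (W-cca (liftMap φ)) (liftMap-colourAut φ-aut)
    ... | Φ-GR@(A , _ , A-aut , _) = α , φ G.ε , α-aut , λ x → sym (GP.//-rightDividesˡ (φ G.ε) (φ x))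
      where
      α β : G.Carrier → G.Carrier
      α x = φ x G.∙ φ G.ε G.⁻¹
      β y = ψ (y G.∙ φ G.ε)
      A∘embed : ∀ a → A (embed i a) ≡ embed i (α a)
      A∘embed a = W-cancelʳ (A (embed i a)) (embed i (α a)) (liftMap φ W.ε) (begin
        A (embed i a) W.∙ liftMap φ W.ε  ≡⟨ GRAut-translation Φ-GR (embed i a) ⟨
        liftMap φ (embed i a)            ≡⟨ liftMap-embed φ i a ⟩
        embed i (α a) W.∙ liftMap φ W.ε  ∎)
      α-aut : IsAutPM1 G.raw S₀ α
      α-aut = autPM1-restrict G.raw W (embed-injective i) (embed-hom i) (embed-⁻¹ i)
        (λ s s∈ → generator-complete (coordinate i s∈)) A-aut A∘embed
        (λ x → trans (cong ψ (GP.//-rightDividesˡ (φ G.ε) (φ x))) (ψφ x))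
        (λ y → trans (cong (G._∙ φ G.ε G.⁻¹) (φψ (y G.∙ φ G.ε))) (GP.//-rightDividesʳ (φ G.ε) y))

corollary3p2 : (G : FinGroup) (m : ℕ) (H : PermGroup (suc m)) →
    NonCCA (FinGroup.raw G) → NonCCA (wreath G H)
corollary3p2 G m H (S₀ , S₀⁻¹ , S₀-connected , ¬cca) =
  connectionSet S₀ , connectionSet-inverseClosed S₀ S₀⁻¹ , connectionSet-connected S₀ S₀-connected ,
  λ W-cca → ¬cca λ φ → mk⇔ (colourAut⇒GRAut S₀ zero W-cca φ) (GRAut⇒colourAut G φ)
  where open WreathProduct G H
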